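{- Let $T$ be a plane rooted tree with at least one edge, and write $Q(T)=c_0+c_1q+\dots+c_Nq^N$. Then $$c_1=\sum_{v\in V(T),\ k_v\ge 1}(k_v-1),$$ where $k_v$ is the number of edges growing upward from $v$. In particular, if every vertex $v$ of $T$ has $k_v\in\{0,2\}$ (a binary tree), then $c_1$ equals the number of vertices of $T$ which are not leaves (i.e. with $k_v=2$).
   Context: A plane rooted tree is a finite tree with a distinguished vertex (the root), embedded in the plane so that it grows upward from the root. A leaf is a vertex of degree $1$ different from the root. For a leaf $v$ of $T$, $r(T,v)$ denotes the number of edges of $T$ lying to the right of the unique path connecting $v$ with the root, and $T-v$ is the plane rooted tree obtained by deleting $v$ and its incident edge. The plucking polynomial $Q(T)\in\mathbb{Z}[q]$ is defined recursively: if $T$ has a single vertex then $Q(T)=1$; otherwise $Q(T)=\sum_{v \text{ leaf of } T} q^{r(T,v)}Q(T-v)$. For a vertex $v$, $k_v$ is the degree of $v$ in the subtree of $T$ growing upward from $v$. -}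

module Defs where

open import Data.Nat using (ℕ; zero; suc; _+_; _∸_; _≤_; _≤?_)
open import Data.Nat.Properties using (_≟_)
open import Data.List using (List; []; _∷_; _++_; map; length; filter; replicate; concatMap)
open import Data.Product using (_×_; _,_)
open import Data.Nat.ListAction using (sum)

-- Plane rooted trees: a vertex together with the ordered (left-to-right)
-- list of subtrees growing upward from it.
data PTree : Set where
  node : List PTree → PTree

mutual
  verts : PTree → ℕ
  verts (node cs) = suc (vertsF cs)

  vertsF : List PTree → ℕ
  vertsF [] = 0
  vertsF (c ∷ cs) = verts c + vertsF cs

edges : PTree → ℕ
edges (node cs) = vertsF cs

-- For a forest of sibling subtrees (the children of some
-- vertex, left to right), list every leaf v lying in it together with
-- (number of edges to the right of the path from v down to the parent,
--  the forest with v deleted).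
-- A sibling subtree s to the right of the path contributes verts s edges
-- (its own edges plus the edge joining it to the parent).
mutual
  delsF : List PTree → List (ℕ × List PTree)
  delsF [] = []
  delsF (node [] ∷ cs) =
    (vertsF cs , cs) ∷ map (λ { (r , cs') → (r , node [] ∷ cs') }) (delsF cs)
  delsF (node (d ∷ ds) ∷ cs) =
    map (λ { (r , t') → (r + vertsF cs , t' ∷ cs) }) (dels (node (d ∷ ds)))
    ++ map (λ { (r , cs') → (r , node (d ∷ ds) ∷ cs') }) (delsF cs)

  -- all leaves v of T (non-root vertices with no children), paired with
  -- (r(T,v), T - v)
  dels : PTree → List (ℕ × PTree)
  dels (node cs) = map (λ { (r , cs') → (r , node cs') }) (delsF cs)

-- Polynomials in ℤ[q] with (here necessarily) nonnegative coefficients,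
-- as little-endian coefficient lists.
Poly : Set
Poly = List ℕ

_⊕_ : Poly → Poly → Poly
[] ⊕ q = q
(a ∷ p) ⊕ [] = a ∷ p
(a ∷ p) ⊕ (b ∷ q) = (a + b) ∷ (p ⊕ q)

shift : ℕ → Poly → Poly
shift r p = replicate r 0 ++ p

coeff : Poly → ℕ → ℕ
coeff [] i = 0
coeff (a ∷ p) zero = a
coeff (a ∷ p) (suc i) = coeff p i

sumP : List Poly → Poly
sumP [] = []
sumP (p ∷ ps) = p ⊕ sumP ps

-- Recursive definition with fuel (= number of edges, which decreases by
-- exactly one under leaf deletion).
Qf : ℕ → PTree → Poly
Qf zero t = 1 ∷ []
Qf (suc n) t = sumP (map (λ { (r , t') → shift r (Qf n t') }) (dels t))

Q : PTree → Poly
Q t = Qf (edges t) t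

mutual
  ks : PTree → List ℕ
  ks (node cs) = length cs ∷ ksF cs

  ksF : List PTree → List ℕ
  ksF [] = []
  ksF (c ∷ cs) = ks c ++ ksF cs

excessSum : PTree → ℕ
excessSum t = sum (map (λ k → k ∸ 1) (filter (1 ≤?_) (ks t)))

data ZeroOrTwo : ℕ → Set where
  k0 : ZeroOrTwo 0
  k2 : ZeroOrTwo 2

numK2 : PTree → ℕ
numK2 t = length (filter (_≟ 2) (ks t))

module Submission where

-- Write c₀(T), c₁(T) for the coefficients of q⁰ and q¹ in Q(T), and
-- E(T) = Σ_v (k_v ∸ 1) for the excess of T.  Unfolding one step of
-- Q(T) = Σ_v q^{r(T,v)} Q(T - v), only leaves with r(T,v) ≤ 1 contribute:
--   c₀(T) = Σ_{r(T,v) = 0} c₀(T - v),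
--   c₁(T) = Σ_{r(T,v) = 0} c₁(T - v) + Σ_{r(T,v) = 1} c₀(T - v).
-- The only leaf with r = 0 is the rightmost leaf v_R, so by induction on the
-- number of edges c₀ = 1 and c₁(T) = c₁(T - v_R) + #{v : r(T,v) = 1}.
-- The combinatorial core is  E(T) = E(T - v_R) + #{v : r(T,v) = 1}:  both
-- increments are 1 exactly when the parent of v_R has at least two children.

open import Defs
open import Function using (_∘_)
open import Data.Nat using (ℕ; _≤_; zero; suc; _+_; _*_; _∸_; _≤?_)
open import Data.Nat.Properties using (_≟_; +-identityʳ; +-suc; *-identityʳ; suc-injective)
open import Data.Nat.Tactic.RingSolver using (solve-∀)
open import Data.Nat.ListAction using (sum)
open import Data.Nat.ListAction.Properties using (sum-++)
open import Data.Product using (_×_; _,_; proj₁; proj₂)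
open import Data.List using (List; []; _∷_; _++_; map; length; filter)
open import Data.List.Properties using (map-∘; map-++; map-cong; map-cong-local)
open import Data.List.Relation.Unary.All using (All; []; _∷_)
import Data.List.Relation.Unary.All as All
open import Data.List.Relation.Unary.All.Properties using (map⁺; ++⁺)
open import Relation.Binary.PropositionalEquality
open ≡-Reasoning

sum-map-∘ : {A B : Set} (h : B → ℕ) (f : A → B) (xs : List A) →
  sum (map h (map f xs)) ≡ sum (map (h ∘ f) xs)
sum-map-∘ h f xs = cong sum (sym (map-∘ xs))

sum-map-++ : {A : Set} (h : A → ℕ) (xs ys : List A) →
  sum (map h (xs ++ ys)) ≡ sum (map h xs) + sum (map h ys)
sum-map-++ h xs ys = trans (cong sum (map-++ h xs ys)) (sum-++ (map h xs) (map h ys))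

sum-map-+ : {A : Set} (f g : A → ℕ) (xs : List A) →
  sum (map (λ x → f x + g x) xs) ≡ sum (map f xs) + sum (map g xs)
sum-map-+ f g [] = refl
sum-map-+ f g (x ∷ xs) = begin
  f x + g x + sum (map (λ x → f x + g x) xs)  ≡⟨ cong (f x + g x +_) (sum-map-+ f g xs) ⟩
  f x + g x + (sum (map f xs) + sum (map g xs)) ≡⟨ shuffle (f x) (g x) _ _ ⟩
  f x + sum (map f xs) + (g x + sum (map g xs)) ∎
  where
  shuffle : ∀ a b c d → a + b + (c + d) ≡ a + c + (b + d)
  shuffle = solve-∀

sum-map-zero : {A : Set} (xs : List A) → sum (map (λ _ → 0) xs) ≡ 0
sum-map-zero [] = refl
sum-map-zero (x ∷ xs) = sum-map-zero xs

coeff-⊕ : ∀ p p' i → coeff (p ⊕ p') i ≡ coeff p i + coeff p' i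
coeff-⊕ [] p' i = refl
coeff-⊕ (a ∷ p) [] i = sym (+-identityʳ _)
coeff-⊕ (a ∷ p) (b ∷ p') zero = refl
coeff-⊕ (a ∷ p) (b ∷ p') (suc i) = coeff-⊕ p p' i

coeff-sumP : ∀ ps i → coeff (sumP ps) i ≡ sum (map (λ p → coeff p i) ps)
coeff-sumP [] zero = refl
coeff-sumP [] (suc i) = refl
coeff-sumP (p ∷ ps) i = trans (coeff-⊕ p (sumP ps) i) (cong (coeff p i +_) (coeff-sumP ps i))

-- ifZero r a = [r = 0]·a   and   isOne r = [r = 1]:  the coefficients of q⁰
-- and q¹ in q^r·p are  ifZero r c₀(p)  and  ifZero r c₁(p) + isOne r·c₀(p).
ifZero : ℕ → ℕ → ℕ
ifZero zero a = a
ifZero (suc _) a = 0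

isOne : ℕ → ℕ
isOne 1 = 1
isOne _ = 0

coeff₀-shift : ∀ r p → coeff (shift r p) 0 ≡ ifZero r (coeff p 0)
coeff₀-shift zero p = refl
coeff₀-shift (suc r) p = refl

coeff₁-shift : ∀ r p → coeff (shift r p) 1 ≡ ifZero r (coeff p 1) + isOne r * coeff p 0
coeff₁-shift zero p = sym (+-identityʳ _)
coeff₁-shift (suc zero) p = sym (+-identityʳ _)
coeff₁-shift (suc (suc r)) p = refl

ifZero-+suc : ∀ r k a → ifZero (r + suc k) a ≡ 0
ifZero-+suc zero k a = refl
ifZero-+suc (suc r) k a = refl

isOne-≥2 : ∀ a b → isOne (suc (a + suc b)) ≡ 0
isOne-≥2 zero b = refl
isOne-≥2 (suc a) b = refl

isOne-+ : ∀ r k → isOne (r + suc k) ≡ ifZero r (isOne (suc k))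
isOne-+ zero k = refl
isOne-+ (suc r) k = isOne-≥2 r k

mutual
  excess : PTree → ℕ
  excess (node cs) = (length cs ∸ 1) + excessF cs

  excessF : List PTree → ℕ
  excessF [] = 0
  excessF (c ∷ cs) = excess c + excessF cs

-- Vertices with k_v = 0 contribute 0 either way, so the filter is irrelevant.
excessSum-unfiltered : ∀ ks → sum (map (_∸ 1) (filter (1 ≤?_) ks)) ≡ sum (map (_∸ 1) ks)
excessSum-unfiltered [] = refl
excessSum-unfiltered (zero ∷ ks) = excessSum-unfiltered ks
excessSum-unfiltered (suc k ∷ ks) = cong (k +_) (excessSum-unfiltered ks)

mutual
  sumPred-ks : ∀ t → sum (map (_∸ 1) (ks t)) ≡ excess t
  sumPred-ks (node cs) = cong ((length cs ∸ 1) +_) (sumPred-ksF cs)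

  sumPred-ksF : ∀ cs → sum (map (_∸ 1) (ksF cs)) ≡ excessF cs
  sumPred-ksF [] = refl
  sumPred-ksF (c ∷ cs) =
    trans (sum-map-++ (_∸ 1) (ks c) (ksF cs)) (cong₂ _+_ (sumPred-ks c) (sumPred-ksF cs))

excessSum≡excess : ∀ t → excessSum t ≡ excess t
excessSum≡excess t = trans (excessSum-unfiltered (ks t)) (sumPred-ks t)

-- For binary trees every non-leaf contributes exactly 2 ∸ 1 = 1.
excessSum-binary : ∀ ks → All ZeroOrTwo ks →
  sum (map (_∸ 1) (filter (1 ≤?_) ks)) ≡ length (filter (_≟ 2) ks)
excessSum-binary [] [] = refl
excessSum-binary (.0 ∷ ks) (k0 ∷ zt) = excessSum-binary ks zt
excessSum-binary (.2 ∷ ks) (k2 ∷ zt) = cong suc (excessSum-binary ks zt)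

deletion-size : ∀ cs → All (λ x → suc (vertsF (proj₂ x)) ≡ vertsF cs) (delsF cs)
deletion-size [] = []
deletion-size (node [] ∷ cs) = refl ∷ map⁺ (All.map (cong suc) (deletion-size cs))
deletion-size (node (d ∷ ds) ∷ cs) =
  ++⁺ (map⁺ (map⁺ (All.map (cong (λ m → suc (m + vertsF cs))) (deletion-size (d ∷ ds)))))
      (map⁺ (All.map (λ {x} p → trans (sym (+-suc (verts (node (d ∷ ds))) (vertsF (proj₂ x))))
                                      (cong (verts (node (d ∷ ds)) +_) p))
                     (deletion-size cs)))

sum-delsF-internal : (h : ℕ × List PTree → ℕ) (d : PTree) (ds cs : List PTree) →
  sum (map h (delsF (node (d ∷ ds) ∷ cs)))
  ≡ sum (map (λ x → h (proj₁ x + vertsF cs , node (proj₂ x) ∷ cs)) (delsF (d ∷ ds)))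
    + sum (map (λ x → h (proj₁ x , node (d ∷ ds) ∷ proj₂ x)) (delsF cs))
sum-delsF-internal h d ds cs =
  trans (sum-map-++ h (map _ (dels (node (d ∷ ds)))) _)
        (cong₂ _+_ (trans (sum-map-∘ h _ (map _ (delsF (d ∷ ds)))) (sum-map-∘ _ _ (delsF (d ∷ ds))))
                   (sum-map-∘ h _ (delsF cs)))

dropRightmost : PTree → List PTree → List PTree
dropRightmost c (c' ∷ cs) = c ∷ dropRightmost c' cs
dropRightmost (node []) [] = []
dropRightmost (node (d ∷ ds)) [] = node (dropRightmost d ds) ∷ []

-- The number of leaves of c ∷ cs with exactly one edge to their right.
nearRightmost : PTree → List PTree → ℕ
nearRightmost c (c' ∷ cs) = isOne (vertsF (c' ∷ cs)) + nearRightmost c' cs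
nearRightmost (node []) [] = 0
nearRightmost (node (d ∷ ds)) [] = nearRightmost d ds

-- The rightmost leaf is the unique leaf with r = 0: summing g(forest - v)
-- over the leaves v with r = 0 just evaluates g at the forest minus v_R.
rightmost-unique : ∀ c cs (g : List PTree → ℕ) →
  sum (map (λ x → ifZero (proj₁ x) (g (proj₂ x))) (delsF (c ∷ cs))) ≡ g (dropRightmost c cs)
rightmost-unique (node []) [] g = +-identityʳ _
rightmost-unique (node []) (node es ∷ cs) g =
  trans (sum-map-∘ _ _ (delsF (node es ∷ cs))) (rightmost-unique (node es) cs (g ∘ (node [] ∷_)))
rightmost-unique (node (d ∷ ds)) [] g = begin
  _ ≡⟨ sum-delsF-internal _ d ds [] ⟩
  sum (map (λ x → ifZero (proj₁ x + 0) (g (node (proj₂ x) ∷ []))) (delsF (d ∷ ds))) + 0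
    ≡⟨ +-identityʳ _ ⟩
  _ ≡⟨ cong sum (map-cong (λ x → cong (λ r → ifZero r _) (+-identityʳ (proj₁ x))) (delsF (d ∷ ds))) ⟩
  sum (map (λ x → ifZero (proj₁ x) (g (node (proj₂ x) ∷ []))) (delsF (d ∷ ds)))
    ≡⟨ rightmost-unique d ds (λ f → g (node f ∷ [])) ⟩
  g (node (dropRightmost d ds) ∷ []) ∎
rightmost-unique (node (d ∷ ds)) (node es ∷ cs) g = begin
  _ ≡⟨ sum-delsF-internal _ d ds (node es ∷ cs) ⟩
  _ ≡⟨ cong₂ _+_ (trans (cong sum (map-cong (λ x → ifZero-+suc (proj₁ x) _ _) (delsF (d ∷ ds))))
                         (sum-map-zero (delsF (d ∷ ds))))
                  refl ⟩
  sum (map (λ x → ifZero (proj₁ x) (g (node (d ∷ ds) ∷ proj₂ x))) (delsF (node es ∷ cs)))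
    ≡⟨ rightmost-unique (node es) cs (g ∘ (node (d ∷ ds) ∷_)) ⟩
  g (node (d ∷ ds) ∷ dropRightmost (node es) cs) ∎

nearRightmost-count : ∀ c cs → sum (map (isOne ∘ proj₁) (delsF (c ∷ cs))) ≡ nearRightmost c cs
nearRightmost-count (node []) [] = refl
nearRightmost-count (node []) (node es ∷ cs) =
  cong (isOne (vertsF (node es ∷ cs)) +_)
       (trans (sum-map-∘ _ _ (delsF (node es ∷ cs))) (nearRightmost-count (node es) cs))
nearRightmost-count (node (d ∷ ds)) [] = begin
  _ ≡⟨ sum-delsF-internal _ d ds [] ⟩
  sum (map (λ x → isOne (proj₁ x + 0)) (delsF (d ∷ ds))) + 0 ≡⟨ +-identityʳ _ ⟩
  _ ≡⟨ cong sum (map-cong (cong isOne ∘ +-identityʳ ∘ proj₁) (delsF (d ∷ ds))) ⟩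
  sum (map (isOne ∘ proj₁) (delsF (d ∷ ds))) ≡⟨ nearRightmost-count d ds ⟩
  nearRightmost d ds ∎
nearRightmost-count (node (d ∷ ds)) (node es ∷ cs) = begin
  _ ≡⟨ sum-delsF-internal _ d ds (node es ∷ cs) ⟩
  _ ≡⟨ cong₂ _+_ (trans (cong sum (map-cong (λ x → isOne-+ (proj₁ x) _) (delsF (d ∷ ds))))
                         (rightmost-unique d ds (λ _ → isOne (vertsF (node es ∷ cs)))))
                  (nearRightmost-count (node es) cs) ⟩
  isOne (vertsF (node es ∷ cs)) + nearRightmost (node es) cs ∎

-- Deleting the rightmost leaf empties the forest iff it was a single leaf.
length-dropRightmost : ∀ c cs →
  suc (length (dropRightmost c cs) ∸ 1) ≡ length (dropRightmost c cs) + isOne (vertsF (c ∷ cs))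
length-dropRightmost (node []) [] = refl
length-dropRightmost (node (node fs ∷ ds)) [] = refl
length-dropRightmost (node es) (node fs ∷ cs) =
  sym (trans (cong (length (dropRightmost (node es) (node fs ∷ cs)) +_) (isOne-≥2 (vertsF es) _))
             (+-identityʳ _))

excess-single : ∀ t → excess (node (t ∷ [])) ≡ excess t
excess-single t = +-identityʳ (excess t)

excess-dropRightmost : ∀ c cs →
  excess (node (c ∷ cs)) ≡ excess (node (dropRightmost c cs)) + nearRightmost c cs
excess-dropRightmost (node []) [] = refl
excess-dropRightmost (node (d ∷ ds)) [] = begin
  excess (node (node (d ∷ ds) ∷ []))               ≡⟨ excess-single (node (d ∷ ds)) ⟩
  excess (node (d ∷ ds))                           ≡⟨ excess-dropRightmost d ds ⟩
  excess (node (dropRightmost d ds)) + nearRightmost d ds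
    ≡⟨ cong (_+ nearRightmost d ds) (sym (excess-single (node (dropRightmost d ds)))) ⟩
  excess (node (node (dropRightmost d ds) ∷ [])) + nearRightmost d ds ∎
excess-dropRightmost c (c' ∷ cs) = begin
  suc (length cs) + (excess c + excessF (c' ∷ cs))  ≡⟨ shuffle₁ (length cs) (excess c) _ ⟩
  excess c + suc (excess (node (c' ∷ cs)))           ≡⟨ cong (λ e → excess c + suc e) (excess-dropRightmost c' cs) ⟩
  excess c + suc ((length R ∸ 1) + excessF R + δ)    ≡⟨ shuffle₂ (excess c) (length R ∸ 1) (excessF R) δ ⟩
  excess c + excessF R + δ + suc (length R ∸ 1)      ≡⟨ cong (excess c + excessF R + δ +_) (length-dropRightmost c' cs) ⟩
  excess c + excessF R + δ + (length R + ω)          ≡⟨ shuffle₃ (excess c) (excessF R) δ (length R) ω ⟩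
  length R + (excess c + excessF R) + (ω + δ)        ∎
  where
  R = dropRightmost c' cs
  δ = nearRightmost c' cs
  ω = isOne (vertsF (c' ∷ cs))
  shuffle₁ : ∀ m a x → suc m + (a + x) ≡ a + suc (m + x)
  shuffle₁ = solve-∀
  shuffle₂ : ∀ a l e d → a + suc (l + e + d) ≡ a + e + d + suc l
  shuffle₂ = solve-∀
  shuffle₃ : ∀ a e d l w → a + e + d + (l + w) ≡ l + (a + e) + (w + d)
  shuffle₃ = solve-∀

coeff-Qf-suc : ∀ n cs i → coeff (Qf (suc n) (node cs)) i
  ≡ sum (map (λ x → coeff (shift (proj₁ x) (Qf n (node (proj₂ x)))) i) (delsF cs))
coeff-Qf-suc n cs i =
  trans (coeff-sumP (map _ (map _ (delsF cs))) i)
        (trans (sum-map-∘ (λ p → coeff p i) _ (map _ (delsF cs))) (sum-map-∘ _ _ (delsF cs)))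

lowCoefficients : ∀ n t → edges t ≡ n → (coeff (Qf n t) 0 ≡ 1) × (coeff (Qf n t) 1 ≡ excess t)
lowCoefficients zero (node []) _ = refl , refl
lowCoefficients zero (node (node es ∷ cs)) ()
lowCoefficients (suc n) (node []) ()
lowCoefficients (suc n) (node (c ∷ cs)) size = c₀ , c₁
  where
  IH : All (λ x → (coeff (Qf n (node (proj₂ x))) 0 ≡ 1)
                × (coeff (Qf n (node (proj₂ x))) 1 ≡ excess (node (proj₂ x))))
           (delsF (c ∷ cs))
  IH = All.map (λ {x} p → lowCoefficients n (node (proj₂ x)) (suc-injective (trans p size)))
               (deletion-size (c ∷ cs))

  c₀ : coeff (Qf (suc n) (node (c ∷ cs))) 0 ≡ 1
  c₀ = begin
    _ ≡⟨ coeff-Qf-suc n (c ∷ cs) 0 ⟩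
    _ ≡⟨ cong sum (map-cong-local (All.map (λ {x} ih →
           trans (coeff₀-shift (proj₁ x) _) (cong (ifZero (proj₁ x)) (proj₁ ih))) IH)) ⟩
    sum (map (λ x → ifZero (proj₁ x) 1) (delsF (c ∷ cs))) ≡⟨ rightmost-unique c cs (λ _ → 1) ⟩
    1 ∎

  c₁ : coeff (Qf (suc n) (node (c ∷ cs))) 1 ≡ excess (node (c ∷ cs))
  c₁ = begin
    _ ≡⟨ coeff-Qf-suc n (c ∷ cs) 1 ⟩
    _ ≡⟨ cong sum (map-cong-local (All.map (λ {x} ih →
           trans (coeff₁-shift (proj₁ x) _)
                 (cong₂ _+_ (cong (ifZero (proj₁ x)) (proj₂ ih))
                            (trans (cong (isOne (proj₁ x) *_) (proj₁ ih)) (*-identityʳ _)))) IH)) ⟩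
    sum (map (λ x → ifZero (proj₁ x) (excess (node (proj₂ x))) + isOne (proj₁ x)) (delsF (c ∷ cs)))
      ≡⟨ sum-map-+ _ _ (delsF (c ∷ cs)) ⟩
    _ ≡⟨ cong₂ _+_ (rightmost-unique c cs (excess ∘ node)) (nearRightmost-count c cs) ⟩
    excess (node (dropRightmost c cs)) + nearRightmost c cs ≡⟨ sym (excess-dropRightmost c cs) ⟩
    excess (node (c ∷ cs)) ∎

-- Corollary 2.4.
corollary2p4 : (T : PTree) → 1 ≤ edges T →
    (coeff (Q T) 1 ≡ excessSum T)
    × (All ZeroOrTwo (ks T) → coeff (Q T) 1 ≡ numK2 T)
corollary2p4 T _ = c₁≡excessSum , λ binary → trans c₁≡excessSum (excessSum-binary (ks T) binary)
  where
  c₁≡excessSum : coeff (Q T) 1 ≡ excessSum T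
  c₁≡excessSum = trans (proj₂ (lowCoefficients (edges T) T refl)) (sym (excessSum≡excess T))
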